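{- Let $\mathcal{B}=(G,S)$ be a semiregular blade. If $K_r$ is a minor of $\mathcal{B}$, then $K_r$ is a minor of $G$.
   Context: All graphs are finite and simple. $K_r$ is the complete graph on $r$ vertices. A graph $H$ is a minor of $G$ if a graph isomorphic to $H$ can be obtained from a subgraph of $G$ by contracting edges. A blade is a pair $(G,S)$ where $G$ is a graph and $S\subsetneq V(G)$. $\mathrm{Fan}(G,S,k)$ is the graph obtained from $k$ disjoint copies of $G$ by identifying the corresponding copies of each vertex of $S$; a graph is a minor of the blade $(G,S)$ if it is a minor of $\mathrm{Fan}(G,S,k)$ for some $k$. A blade $(G,S)$ is semiregular if $G[S]$ is complete, $G\setminus S$ is connected, and each vertex of $S$ has a neighbor in $V(G)-S$. -}

module Defs where

open import Data.Nat using (ℕ)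
open import Data.Fin using (Fin)
open import Data.Bool using (Bool; true; false)
open import Data.Maybe using (Maybe; just; nothing)
open import Data.Product using (Σ; ∃; _×_; _,_)
open import Relation.Binary.PropositionalEquality using (_≡_; _≢_)
open import Relation.Nullary using (¬_)

record Graph (V : Set) : Set₁ where
  field
    Adj    : V → V → Set
    sym    : ∀ {u v} → Adj u v → Adj v u
    irrefl : ∀ {v} → ¬ Adj v v
open Graph public

FinGraph : ℕ → Set₁
FinGraph n = Graph (Fin n)

K : (r : ℕ) → FinGraph r
K r = record { Adj = λ i j → i ≢ j ; sym = λ p q → p (Relation.Binary.PropositionalEquality.sym q) ; irrefl = λ p → p Relation.Binary.PropositionalEquality.refl }

data WalkIn {V : Set} (G : Graph V) (P : V → Set) : V → V → Set where
  here : ∀ {v} → P v → WalkIn G P v v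
  step : ∀ {u w v} → P u → Adj G u w → WalkIn G P w v → WalkIn G P u v

ConnectedOn : {V : Set} → Graph V → (V → Set) → Set
ConnectedOn G P = ∀ u v → P u → P v → WalkIn G P u v

-- H is a minor of G, given by a minor model (branch sets): a partial map
-- φ : V(G) ⇀ V(H); the branch set of x is φ⁻¹(x).  Branch sets are disjoint
-- by construction, nonempty, induce connected subgraphs, and adjacent
-- vertices of H have adjacent branch sets.
record MinorModel {U W : Set} (H : Graph U) (G : Graph W) : Set where
  field
    φ         : W → Maybe U
    nonempty  : ∀ x → ∃ λ w → φ w ≡ just x
    connected : ∀ x → ConnectedOn G (λ w → φ w ≡ just x)
    edges     : ∀ {x y} → Adj H x y →
                ∃ λ w → ∃ λ w' → φ w ≡ just x × φ w' ≡ just y × Adj G w w'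

_≼_ : {U W : Set} → Graph U → Graph W → Set
H ≼ G = MinorModel H G

-- Vertex subsets of Fin n as Boolean predicates; v ∈ S iff S v ≡ true.
-- Vertices of Fan(G,S,k): shared vertices of S, and k copies of each vertex outside S.
data FanV (n : ℕ) (S : Fin n → Bool) (k : ℕ) : Set where
  shared : (v : Fin n) → S v ≡ true → FanV n S k
  copy   : (i : Fin k) → (v : Fin n) → S v ≡ false → FanV n S k

FanAdj : ∀ {n} (G : FinGraph n) (S : Fin n → Bool) (k : ℕ) → FanV n S k → FanV n S k → Set
FanAdj G S k (shared u _) (shared v _) = Adj G u v
FanAdj G S k (shared u _) (copy j v _) = Adj G u v
FanAdj G S k (copy i u _) (shared v _) = Adj G u v
FanAdj G S k (copy i u _) (copy j v _) = i ≡ j × Adj G u v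

Fan : ∀ {n} (G : FinGraph n) (S : Fin n → Bool) (k : ℕ) → Graph (FanV n S k)
Fan G S k = record { Adj = FanAdj G S k ; sym = λ {a} {b} → s {a} {b} ; irrefl = λ {a} → ir {a} }
  where
  s : ∀ {a b} → FanAdj G S k a b → FanAdj G S k b a
  s {shared u _} {shared v _} p = sym G p
  s {shared u _} {copy j v _} p = sym G p
  s {copy i u _} {shared v _} p = sym G p
  s {copy i u _} {copy j v _} (e , p) = Relation.Binary.PropositionalEquality.sym e , sym G p
  ir : ∀ {a} → ¬ FanAdj G S k a a
  ir {shared u _} p = irrefl G p
  ir {copy i u _} (_ , p) = irrefl G p

record Blade : Set₁ where
  field
    n      : ℕ
    G      : FinGraph n
    S      : Fin n → Bool
    proper : ∃ λ v → S v ≡ false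

MinorOfBlade : {U : Set} → Graph U → Blade → Set
MinorOfBlade H B = ∃ λ k → H ≼ Fan (Blade.G B) (Blade.S B) k

record Semiregular (B : Blade) : Set where
  open Blade B
  field
    S-complete  : ∀ u v → S u ≡ true → S v ≡ true → u ≢ v → Adj G u v
    rest-conn   : ConnectedOn G (λ v → S v ≡ false)
    S-neighbour : ∀ u → S u ≡ true → ∃ λ v → S v ≡ false × Adj G u v

module Submission where

-- Let (X_x) be a model of K_r in Fan(G,S,k).  Call a branch set *touching* if it contains a shared vertex
-- and *private* otherwise.  A private branch set cannot leave its copy of
-- G \ S, and two private branch sets are adjacent, so all private branch
-- sets lie in one common copy i.  Let the *layer* be the shared vertices
-- together with copy i (only the shared vertices if there is no private
-- branch set).  Restricting the model to the layer still gives a model: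
-- inside a touching branch set every walk from a layer vertex to a shared
-- vertex t can be cut short at its first shared vertex, which is adjacent
-- to t because S is a clique.  Finally the projection Fan(G,S,k) → G is a
-- homomorphism that is bijective from the layer onto its image, and a
-- model restricted to such a vertex set pulls back to a model in G.

open import Defs hiding (sym)
open import Axiom.UniquenessOfIdentityProofs using (module Decidable⇒UIP)
open import Data.Nat using (ℕ)
open import Data.Fin using (Fin) renaming (_≟_ to _≟ᶠ_)
open import Data.Fin.Properties using (any?)
open import Data.Bool using (Bool; true; false) renaming (_≟_ to _≟ᵇ_)
open import Data.Maybe using (Maybe; just; nothing; _>>=_)
open import Data.Maybe.Properties using (≡-dec; just-injective)
open import Data.Product using (∃; ∃₂; _×_; _,_; proj₁)
open import Data.Unit using (⊤; tt)
open import Data.Empty using (⊥-elim)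
open import Relation.Nullary using (¬_; Dec; yes; no)
open import Relation.Nullary.Decidable using (¬?)
open import Relation.Binary.PropositionalEquality
  using (_≡_; _≢_; refl; sym; trans; cong; subst; subst₂)

-- Equality proofs between booleans are unique (Hedberg); membership
-- proofs S v ≡ b carried by fan vertices are therefore irrelevant.
open Decidable⇒UIP _≟ᵇ_ renaming (≡-irrelevant to bool-uip)

module _ {V : Set} {G : Graph V} {P : V → Set} where

  walk-source : ∀ {a b} → WalkIn G P a b → P a
  walk-source (here p) = p
  walk-source (step p _ _) = p

  walk-target : ∀ {a b} → WalkIn G P a b → P b
  walk-target (here p) = p
  walk-target (step _ _ w) = walk-target w

  _++ʷ_ : ∀ {a b c} → WalkIn G P a b → WalkIn G P b c → WalkIn G P a c
  here _ ++ʷ w = w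
  step p e w ++ʷ w' = step p e (w ++ʷ w')

  reverseʷ : ∀ {a b} → WalkIn G P a b → WalkIn G P b a
  reverseʷ (here p) = here p
  reverseʷ (step p e w) = reverseʷ w ++ʷ step (walk-source w) (Graph.sym G e) (here p)

Hom : {V W : Set} → Graph V → Graph W → (V → W) → Set
Hom F G f = ∀ a b → Adj F a b → Adj G (f a) (f b)

mapWalk : {V W : Set} {F : Graph V} {G : Graph W} {P : V → Set} {Q : W → Set}
  (f : V → W) → Hom F G f → (∀ {a} → P a → Q (f a)) →
  ∀ {a b} → WalkIn F P a b → WalkIn G Q (f a) (f b)
mapWalk f hom inQ (here p) = here (inQ p)
mapWalk f hom inQ (step {u} {w} p e rest) =
  step (inQ p) (hom u w e) (mapWalk f hom inQ rest)

module _ {U V : Set} {H : Graph U} {F : Graph V} where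

  Trace : H ≼ F → (V → Set) → U → V → Set
  Trace m K x a = K a × MinorModel.φ m a ≡ just x

  record RestrictsTo (m : H ≼ F) (K : V → Set) : Set where
    field
      inhabited : ∀ x → ∃ (Trace m K x)
      connected : ∀ x → ConnectedOn F (Trace m K x)
      edges     : ∀ {x y} → Adj H x y →
                  ∃₂ λ a b → Trace m K x a × Trace m K y b × Adj F a b

module PullBack {U V W : Set} {H : Graph U} {F : Graph V} {G : Graph W}
  (π : V → W) (π-hom : Hom F G π)
  (K : V → Set) (σ : W → Maybe V)
  (σ-sound    : ∀ {u a} → σ u ≡ just a → π a ≡ u × K a)
  (σ-complete : ∀ {a} → K a → σ (π a) ≡ just a)
  where

  module _ (m : H ≼ F) where
    open MinorModel m using (φ)

    φ' : W → Maybe U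
    φ' u = σ u >>= φ

    pushed : ∀ {x a} → Trace m K x a → φ' (π a) ≡ just x
    pushed {a = a} (ka , e) rewrite σ-complete ka = e

    pulled : ∀ {u x} → φ' u ≡ just x → ∃ λ a → π a ≡ u × Trace m K x a
    pulled {u} e with σ u in eq
    ... | just a with σ-sound eq
    ...   | πa≡u , ka = a , πa≡u , ka , e

    pullback : RestrictsTo m K → H ≼ G
    pullback res = record
      { φ         = φ'
      ; nonempty  = λ x → let a , ta = inhabited x in π a , pushed ta
      ; connected = connected'
      ; edges     = λ xy → let a , b , ta , tb , ab = edges xy
                           in π a , π b , pushed ta , pushed tb , π-hom a b ab
      }
      where
      open RestrictsTo res
      connected' : ∀ x → ConnectedOn G (λ u → φ' u ≡ just x)
      connected' x u v eu ev with pulled eu | pulled ev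
      ... | a , πa≡u , ta | b , πb≡v , tb =
        subst₂ (WalkIn G (λ w → φ' w ≡ just x)) πa≡u πb≡v
          (mapWalk π π-hom pushed (connected x a b ta tb))

module Layers {n : ℕ} (G : FinGraph n) (S : Fin n → Bool) (k : ℕ) where

  FV : Set
  FV = FanV n S k

  F : Graph FV
  F = Fan G S k

  shared-irrelevant : ∀ {v} (p q : S v ≡ true) → _≡_ {A = FV} (shared v p) (shared v q)
  shared-irrelevant {v} p q = cong (shared v) (bool-uip p q)

  copy-irrelevant : ∀ {i v} (p q : S v ≡ false) → _≡_ {A = FV} (copy i v p) (copy i v q)
  copy-irrelevant {i} {v} p q = cong (copy i v) (bool-uip p q)

  π : FV → Fin n
  π (shared v _) = v
  π (copy _ v _) = v

  π-hom : Hom F G π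
  π-hom (shared _ _) (shared _ _) e = e
  π-hom (shared _ _) (copy _ _ _) e = e
  π-hom (copy _ _ _) (shared _ _) e = e
  π-hom (copy _ _ _) (copy _ _ _) (_ , e) = e

  InLayer : Maybe (Fin k) → FV → Set
  InLayer c (shared _ _) = ⊤
  InLayer c (copy i _ _) = c ≡ just i

  copy-step : ∀ {c i u q b} → InLayer c (copy i u q) →
              FanAdj G S k (copy i u q) b → InLayer c b
  copy-step {b = shared _ _} _ _ = tt
  copy-step {b = copy _ _ _} c≡i (refl , _) = c≡i

  lift : Maybe (Fin k) → (v : Fin n) → (b : Bool) → S v ≡ b → Maybe FV
  lift c v true p = just (shared v p)
  lift nothing v false q = nothing
  lift (just i) v false q = just (copy i v q)

  σ : Maybe (Fin k) → Fin n → Maybe FV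
  σ c v = lift c v (S v) refl

  lift-sound : ∀ c {v a} b (q : S v ≡ b) → lift c v b q ≡ just a → π a ≡ v × InLayer c a
  lift-sound c true q refl = refl , tt
  lift-sound (just i) false q refl = refl , refl

  σ-sound : ∀ c {v a} → σ c v ≡ just a → π a ≡ v × InLayer c a
  σ-sound c = lift-sound c _ refl

  lift-shared : ∀ c {v} b (q : S v ≡ b) (p : S v ≡ true) → lift c v b q ≡ just (shared v p)
  lift-shared c true q p = cong just (shared-irrelevant q p)
  lift-shared c false q p with trans (sym q) p
  ... | ()

  lift-copy : ∀ {i v} b (q : S v ≡ b) (p : S v ≡ false) →
              lift (just i) v b q ≡ just (copy i v p)
  lift-copy false q p = cong just (copy-irrelevant q p)
  lift-copy true q p with trans (sym q) p
  ... | ()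

  σ-complete : ∀ c {a} → InLayer c a → σ c (π a) ≡ just a
  σ-complete c {shared v p} _ = lift-shared c _ refl p
  σ-complete c {copy i v p} refl = lift-copy _ refl p

module Collapse {n : ℕ} (G : FinGraph n) (S : Fin n → Bool)
  (S-complete : ∀ u v → S u ≡ true → S v ≡ true → u ≢ v → Adj G u v)
  {k r : ℕ} (m : K r ≼ Fan G S k) where

  open Layers G S k
  open MinorModel m

  Branch : Fin r → FV → Set
  Branch x w = φ w ≡ just x

  Touches : Fin r → Set
  Touches x = ∃ λ v → ∃ λ (p : S v ≡ true) → Branch x (shared v p)

  touches? : ∀ x → Dec (Touches x)
  touches? x = any? shared-in?
    where
    shared-in? : ∀ v → Dec (∃ λ (p : S v ≡ true) → Branch x (shared v p))
    shared-in? v with S v ≟ᵇ true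
    ... | no ¬p = no λ (p , _) → ¬p p
    ... | yes p with ≡-dec _≟ᶠ_ (φ (shared v p)) (just x)
    ...   | yes e = yes (p , e)
    ...   | no ¬e = no λ (p' , e) → ¬e (subst (λ w → Branch x w) (shared-irrelevant p' p) e)

  -- Within a private branch set every step starts in a copy, so it keeps
  -- us in the layer.
  private-step : ∀ {c x a b} → ¬ Touches x → Branch x a → InLayer c a →
                 FanAdj G S k a b → InLayer c b
  private-step {a = shared v p} ¬t xa _ _ = ⊥-elim (¬t (v , p , xa))
  private-step {a = copy _ _ _} ¬t xa ca ab = copy-step ca ab

  private-walk : ∀ {c x a b} → ¬ Touches x → WalkIn F (Branch x) a b → InLayer c a →
                 WalkIn F (Trace m (InLayer c) x) a b
  private-walk ¬t (here xa) ca = here (ca , xa)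
  private-walk ¬t (step xa ab rest) ca =
    step (ca , xa) ab (private-walk ¬t rest (private-step ¬t xa ca ab))

  private-reach : ∀ {c x a b} → ¬ Touches x → WalkIn F (Branch x) a b →
                  InLayer c a → InLayer c b
  private-reach ¬t w ca = proj₁ (walk-target (private-walk ¬t w ca))

  -- A walk in branch set x from a layer vertex to a shared vertex t,
  -- short-cut at its first shared vertex (S is a clique in the fan).
  shortcut : ∀ {c x a t} (pt : S t ≡ true) → WalkIn F (Branch x) a (shared t pt) →
             InLayer c a → WalkIn F (Trace m (InLayer c) x) a (shared t pt)
  shortcut pt (here xa) ca = here (ca , xa)
  shortcut {t = t} pt (step {shared u p} xa ab rest) _ with u ≟ᶠ t
  ... | yes refl = subst (WalkIn F _ (shared t p)) (shared-irrelevant p pt) (here (tt , xa))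
  ... | no u≢t = step (tt , xa) (S-complete u t p pt u≢t) (here (tt , walk-target rest))
  shortcut pt (step {copy i u q} xa ab rest) ca =
    step (ca , xa) ab (shortcut pt rest (copy-step ca ab))

  Confined : Maybe (Fin k) → Set
  Confined c = ∀ x w → ¬ Touches x → Branch x w → InLayer c w

  restricts : ∀ {c} → Confined c → RestrictsTo m (InLayer c)
  restricts {c} conf = record { inhabited = inhabited ; connected = connected' ; edges = edges' }
    where
    inhabited : ∀ x → ∃ (Trace m (InLayer c) x)
    inhabited x with touches? x
    ... | yes (s , ps , xs) = shared s ps , tt , xs
    ... | no ¬t = let w , xw = nonempty x in w , conf x w ¬t xw , xw

    connected' : ∀ x → ConnectedOn F (Trace m (InLayer c) x)
    connected' x a b (ca , xa) (cb , xb) with touches? x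
    ... | no ¬t = private-walk ¬t (connected x a b xa xb) ca
    ... | yes (s , ps , xs) =
      shortcut ps (connected x a (shared s ps) xa xs) ca
      ++ʷ reverseʷ (shortcut ps (connected x b (shared s ps) xb xs) cb)

    edges' : ∀ {x y} → Adj (K r) x y → ∃₂ λ a b →
             Trace m (InLayer c) x a × Trace m (InLayer c) y b × Adj F a b
    edges' {x} {y} x≢y with touches? x | touches? y
    ... | yes (s , ps , xs) | yes (t , pt , yt) =
      shared s ps , shared t pt , (tt , xs) , (tt , yt) , S-complete s t ps pt s≢t
      where
      s≢t : s ≢ t
      s≢t refl = x≢y (just-injective
                   (trans (sym xs) (trans (cong (λ p → φ (shared s p)) (bool-uip ps pt)) yt)))
    ... | no ¬t | _ =
      let a , b , xa , yb , ab = edges x≢y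
          ca = conf x a ¬t xa
      in a , b , (ca , xa) , (private-step ¬t xa ca ab , yb) , ab
    ... | yes _ | no ¬t =
      let a , b , xa , yb , ab = edges x≢y
          cb = conf y b ¬t yb
      in a , b , (private-step ¬t yb cb (Graph.sym F {a} {b} ab) , xa) , (cb , yb) , ab

  -- Some layer confines all private branch sets: they pairwise touch, so
  -- they all live in the copy of any one of them.
  confining-layer : ∃ Confined
  confining-layer with any? (λ x → ¬? (touches? x))
  ... | no none = nothing , λ x _ ¬t _ → ⊥-elim (none (x , ¬t))
  ... | yes (x₀ , ¬t₀) with nonempty x₀
  ...   | shared v p , x₀v = ⊥-elim (¬t₀ (v , p , x₀v))
  ...   | w₀@(copy i₀ _ _) , x₀w₀ = just i₀ , confined
    where
    confined : Confined (just i₀)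
    confined y w ¬t yw with x₀ ≟ᶠ y
    ... | yes refl = private-reach ¬t₀ (connected x₀ w₀ w x₀w₀ yw) refl
    ... | no x₀≢y =
      let a , b , x₀a , yb , ab = edges x₀≢y
          ca = private-reach ¬t₀ (connected x₀ w₀ a x₀w₀ x₀a) refl
      in private-reach ¬t (connected y b w yb yw) (private-step ¬t₀ x₀a ca ab)

  collapse : K r ≼ G
  collapse =
    let c , conf = confining-layer
    in PullBack.pullback π π-hom (InLayer c) (σ c) (σ-sound c) (σ-complete c) m (restricts conf)

lemma2p7 : (B : Blade) → Semiregular B → (r : ℕ) →
    MinorOfBlade (K r) B → K r ≼ Blade.G B
lemma2p7 B sr r (k , m) =
  Collapse.collapse (Blade.G B) (Blade.S B) (Semiregular.S-complete sr) m
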